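{- Assume the abc conjecture holds. If $k$ and $r$ are fixed positive integers with $\gcd(k,r)=1$, then there are only finitely many powerful numbers of the form $k^n+r$ with $n$ a positive integer.
   Context: For a positive integer $n$, $\mathrm{rad}(n)$ denotes the product of the distinct primes dividing $n$. The abc conjecture states: for every real $\epsilon>0$ there are only finitely many triples $(a,b,c)$ of coprime positive integers with $a+b=c$ and $c>(\mathrm{rad}(abc))^{1+\epsilon}$. A positive integer $z$ is powerful if $p^2\mid z$ for every prime $p$ with $p\mid z$. -}

module Defs where

open import Data.Nat using (ℕ; zero; suc; _+_; _*_; _^_; _≤_; _<_)
open import Data.Nat.Divisibility using (_∣_; _∣?_)
open import Data.Nat.Primality using (Prime; prime?)
open import Data.Nat.Coprimality using (Coprime)
open import Data.List using (List; upTo; filter)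
open import Data.Nat.ListAction using (product)
open import Data.Product using (_×_; ∃)
open import Relation.Nullary.Decidable using (_×-dec_)
open import Relation.Binary.PropositionalEquality using (_≡_)

primeDivisors : ℕ → List ℕ
primeDivisors n = filter (λ p → prime? p ×-dec (p ∣? n)) (upTo (suc n))

rad : ℕ → ℕ
rad n = product (primeDivisors n)

Powerful : ℕ → Set
Powerful z = 0 < z × (∀ p → Prime p → p ∣ z → p ^ 2 ∣ z)

-- abc conjecture.  ε > 0 is taken rational, ε = e / q with e, q ≥ 1
-- (equivalent to real ε, by monotonicity in ε).
-- c > rad(abc)^(1 + e/q)  ⟺  c^q > rad(abc)^(q + e).
-- "only finitely many triples" is rendered as: c is bounded (a, b < c).
ABC : Set
ABC = ∀ e q → 0 < e → 0 < q →
  ∃ λ B → ∀ a b c → 0 < a → 0 < b →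
    Coprime a b → Coprime a c → Coprime b c → a + b ≡ c →
    rad (a * b * c) ^ (q + e) < c ^ q → c ≤ B

-- Take ε = 1/2 in the abc conjecture for the triple (k^n, r, c) with c = k^n + r.
-- Every prime dividing k^n r c divides k, r or c, so rad(k^n r c) ≤ k r rad(c), and
-- rad(c)^2 ≤ c because c is powerful. Hence rad(k^n r c)^6 ≤ (k r)^6 c^3 < c^4
-- as soon as c > (k r)^6, and then abc bounds c.
module Submission where

open import Defs
open import Data.Nat using (ℕ; zero; suc; _+_; _*_; _^_; _≤_; _<_; _⊔_; s≤s; z≤n; NonZero; >-nonZero; nonTrivial⇒≢1; _≤?_)
open import Data.Nat.Properties
open import Algebra.Properties.CommutativeSemigroup *-commutativeSemigroup using (interchange)
open import Data.Nat.Divisibility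
open import Data.Nat.Primality
open import Data.Nat.Primality.Factorisation using (factorisationHasAllPrimeFactors)
open import Data.Nat.Coprimality as Coprimality using (Coprime; coprime-divisor; coprime-+; 1-coprimeTo)
open import Data.Nat.ListAction using (product)
open import Data.Nat.ListAction.Properties using (∈⇒∣product)
open import Data.List using ([]; _∷_; upTo)
open import Data.List.Relation.Unary.All as All using (All; []; _∷_)
open import Data.List.Relation.Unary.AllPairs using (_∷_)
open import Data.List.Relation.Unary.Unique.Propositional using (Unique)
import Data.List.Relation.Unary.Unique.Propositional.Properties as Unique
open import Data.List.Membership.Propositional using (_∈_)
open import Data.List.Membership.Propositional.Properties using (∈-filter⁻; ∈-filter⁺; ∈-upTo⁺)
open import Data.Product using (∃; _,_; _×_; proj₁; proj₂)
open import Data.Sum using (inj₁; inj₂)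
open import Relation.Nullary using (¬_; yes; no; contradiction)
open import Relation.Nullary.Decidable using (_×-dec_)
open import Relation.Unary using (Decidable)
open import Relation.Binary.PropositionalEquality using (_≡_; _≢_; refl; sym; cong; subst; module ≡-Reasoning)

^-distribʳ-* : ∀ m n o → (m * n) ^ o ≡ m ^ o * n ^ o
^-distribʳ-* m n zero    = refl
^-distribʳ-* m n (suc o) = begin
  m * n * (m * n) ^ o     ≡⟨ cong (m * n *_) (^-distribʳ-* m n o) ⟩
  m * n * (m ^ o * n ^ o) ≡⟨ interchange m n (m ^ o) (n ^ o) ⟩
  m * m ^ o * (n * n ^ o) ∎
  where open ≡-Reasoning

prime≢1 : ∀ {p} → Prime p → p ≢ 1
prime≢1 p-prime = nonTrivial⇒≢1 {{prime⇒nonTrivial p-prime}}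

prime∣m^n⇒∣m : ∀ {p m} n → Prime p → p ∣ m ^ n → p ∣ m
prime∣m^n⇒∣m zero    p-prime p∣1 = contradiction (∣1⇒≡1 p∣1) (prime≢1 p-prime)
prime∣m^n⇒∣m {m = m} (suc n) p-prime p∣m^n with euclidsLemma m (m ^ n) p-prime p∣m^n
... | inj₁ p∣m   = p∣m
... | inj₂ p∣m^n = prime∣m^n⇒∣m n p-prime p∣m^n

prime∤⇒coprime : ∀ {p m} → Prime p → ¬ p ∣ m → Coprime p m
prime∤⇒coprime p-prime p∤m (d∣p , d∣m) with prime⇒irreducible p-prime d∣p
... | inj₁ d≡1 = d≡1
... | inj₂ refl = contradiction d∣m p∤m

coprime-* : ∀ {m n o} → Coprime m o → Coprime n o → Coprime (m * n) o
coprime-* {m} {n} {o} m⊥o n⊥o {d} (d∣mn , d∣o) = n⊥o (coprime-divisor d⊥m d∣mn , d∣o)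
  where
  d⊥m : Coprime d m
  d⊥m (e∣d , e∣m) = m⊥o (e∣m , ∣-trans e∣d d∣o)

coprime-^ : ∀ {m o} → Coprime m o → ∀ n → Coprime (m ^ n) o
coprime-^ m⊥o zero    = 1-coprimeTo _
coprime-^ m⊥o (suc n) = coprime-* m⊥o (coprime-^ m⊥o n)

coprime-^-^ : ∀ {m o} → Coprime m o → ∀ n → Coprime (m ^ n) (o ^ n)
coprime-^-^ m⊥o n = coprime-^ (Coprimality.sym (coprime-^ (Coprimality.sym m⊥o) n)) n

coprime-∣⇒*-∣ : ∀ {m n o} → Coprime m n → m ∣ o → n ∣ o → m * n ∣ o
coprime-∣⇒*-∣ {m} {n} m⊥n (divides q refl) n∣qm =
  subst (m * n ∣_) (*-comm m q) (*-monoʳ-∣ m (coprime-divisor n⊥m (subst (n ∣_) (*-comm q m) n∣qm)))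
  where
  n⊥m : Coprime n m
  n⊥m = Coprimality.sym m⊥n

product-^-∣ : ∀ {o} j ps → All Prime ps → Unique ps → All (λ p → p ^ j ∣ o) ps → product ps ^ j ∣ o
product-^-∣ {o} j []       _ _ _ = subst (_∣ o) (sym (^-zeroˡ j)) (1∣ o)
product-^-∣ {o} j (p ∷ ps) (p-prime ∷ ps-prime) (p∉ps ∷ ps-unique) (p^j∣o ∷ ps^j∣o) =
  subst (_∣ o) (sym (^-distribʳ-* p (product ps) j))
    (coprime-∣⇒*-∣ (coprime-^-^ (prime∤⇒coprime p-prime p∤ps) j) p^j∣o
      (product-^-∣ j ps ps-prime ps-unique ps^j∣o))
  where
  p∤ps : ¬ p ∣ product ps
  p∤ps p∣ps = All.lookup p∉ps (factorisationHasAllPrimeFactors p-prime p∣ps ps-prime) refl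

primeDivisor? : ∀ n → Decidable (λ p → Prime p × p ∣ n)
primeDivisor? n p = prime? p ×-dec (p ∣? n)

∈-primeDivisors⁻ : ∀ {n p} → p ∈ primeDivisors n → Prime p × p ∣ n
∈-primeDivisors⁻ {n} p∈ = proj₂ (∈-filter⁻ (primeDivisor? n) {xs = upTo (suc n)} p∈)

∈-primeDivisors⁺ : ∀ {n p} → .{{NonZero n}} → Prime p → p ∣ n → p ∈ primeDivisors n
∈-primeDivisors⁺ {n} p-prime p∣n = ∈-filter⁺ (primeDivisor? n) (∈-upTo⁺ (s≤s (∣⇒≤ p∣n))) (p-prime , p∣n)

primeDivisors-allPrime : ∀ n → All Prime (primeDivisors n)
primeDivisors-allPrime n = All.tabulate (λ p∈ → proj₁ (∈-primeDivisors⁻ {n} p∈))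

primeDivisors-unique : ∀ n → Unique (primeDivisors n)
primeDivisors-unique n = Unique.filter⁺ (primeDivisor? n) (Unique.upTo⁺ (suc n))

rad≢0 : ∀ n → NonZero (rad n)
rad≢0 n = productOfPrimes≢0 (primeDivisors-allPrime n)

rad-^-∣ : ∀ {m o} j → (∀ {p} → Prime p → p ∣ m → p ^ j ∣ o) → rad m ^ j ∣ o
rad-^-∣ {m} j p^j∣o = product-^-∣ j _ (primeDivisors-allPrime m) (primeDivisors-unique m)
  (All.tabulate (λ p∈ → let p-prime , p∣m = ∈-primeDivisors⁻ {m} p∈ in p^j∣o p-prime p∣m))

rad-∣ : ∀ {m o} → (∀ {p} → Prime p → p ∣ m → p ∣ o) → rad m ∣ o
rad-∣ {m} {o} p∣o = subst (_∣ o) (*-identityʳ (rad m))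
  (rad-^-∣ 1 (λ {p} p-prime p∣m → subst (_∣ o) (sym (*-identityʳ p)) (p∣o p-prime p∣m)))

prime∣⇒∣rad : ∀ {n p} → .{{NonZero n}} → Prime p → p ∣ n → p ∣ rad n
prime∣⇒∣rad p-prime p∣n = ∈⇒∣product (∈-primeDivisors⁺ p-prime p∣n)

powerful⇒rad²∣ : ∀ {c} → Powerful c → rad c ^ 2 ∣ c
powerful⇒rad²∣ (_ , powerful) = rad-^-∣ 2 (powerful _)

rad-∣-*-rad : ∀ a b n {c} → .{{NonZero c}} → rad (a ^ n * b * c) ∣ a * b * rad c
rad-∣-*-rad a b n {c} = rad-∣ divides-abc
  where
  divides-abc : ∀ {p} → Prime p → p ∣ a ^ n * b * c → p ∣ a * b * rad c
  divides-abc p-prime p∣abc with euclidsLemma (a ^ n * b) c p-prime p∣abc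
  ... | inj₂ p∣c = ∣n⇒∣m*n (a * b) (prime∣⇒∣rad p-prime p∣c)
  ... | inj₁ p∣ab with euclidsLemma (a ^ n) b p-prime p∣ab
  ...   | inj₁ p∣a^n = ∣m⇒∣m*n (rad c) (∣m⇒∣m*n b (prime∣m^n⇒∣m n p-prime p∣a^n))
  ...   | inj₂ p∣b   = ∣m⇒∣m*n (rad c) (∣n⇒∣m*n a p∣b)

powerful-rad⁶<c⁴ : ∀ {c R} K → Powerful c → R ≤ K * rad c → K ^ 6 < c → R ^ 6 < c ^ 4
powerful-rad⁶<c⁴ {c} {R} K c-powerful@(c>0 , _) R≤Krad K⁶<c = begin-strict
  R ^ 6                     ≤⟨ ^-monoˡ-≤ 6 R≤Krad ⟩
  (K * rad c) ^ 6           ≡⟨ ^-distribʳ-* K (rad c) 6 ⟩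
  K ^ 6 * rad c ^ 6         ≡⟨ cong (K ^ 6 *_) (sym (^-*-assoc (rad c) 2 3)) ⟩
  K ^ 6 * (rad c ^ 2) ^ 3   ≤⟨ *-monoʳ-≤ (K ^ 6) (^-monoˡ-≤ 3 (∣⇒≤ (powerful⇒rad²∣ c-powerful))) ⟩
  K ^ 6 * c ^ 3             <⟨ *-monoˡ-< (c ^ 3) {{m^n≢0 c 3}} K⁶<c ⟩
  c * c ^ 3                 ∎
  where
  open ≤-Reasoning
  instance
    c≢0 : NonZero c
    c≢0 = >-nonZero c>0

powerful-^-+-rad⁶<c⁴ : ∀ {a b} n → .{{NonZero a}} → .{{NonZero b}} →
  Powerful (a ^ n + b) → (a * b) ^ 6 < a ^ n + b →
  rad (a ^ n * b * (a ^ n + b)) ^ 6 < (a ^ n + b) ^ 4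
powerful-^-+-rad⁶<c⁴ {a} {b} n c-powerful@(c>0 , _) =
  powerful-rad⁶<c⁴ (a * b) c-powerful (∣⇒≤ {{ab·rad≢0}} (rad-∣-*-rad a b n {{>-nonZero c>0}}))
  where
  ab·rad≢0 : NonZero (a * b * rad (a ^ n + b))
  ab·rad≢0 = m*n≢0 (a * b) (rad (a ^ n + b)) {{m*n≢0 a b}} {{rad≢0 (a ^ n + b)}}

coprime⇒coprime-+ : ∀ {m n} → Coprime m n → Coprime m (m + n) × Coprime n (m + n)
coprime⇒coprime-+ {m} {n} m⊥n =
    Coprimality.sym (coprime-+ (Coprimality.sym m⊥n))
  , subst (Coprime n) (+-comm n m) (Coprimality.sym (coprime-+ m⊥n))

mainTheorem3 : ABC → (k r : ℕ) → 0 < k → 0 < r → Coprime k r →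
    ∃ λ B → ∀ n → 0 < n → Powerful (k ^ n + r) → k ^ n + r ≤ B
mainTheorem3 abc k r k>0 r>0 k⊥r with abc 2 4 (s≤s z≤n) (s≤s z≤n)
... | B , abc-bound = B ⊔ (k * r) ^ 6 , bounded
  where
  instance
    k≢0 : NonZero k
    k≢0 = >-nonZero k>0
    r≢0 : NonZero r
    r≢0 = >-nonZero r>0
  bounded : ∀ n → 0 < n → Powerful (k ^ n + r) → k ^ n + r ≤ B ⊔ (k * r) ^ 6
  bounded n _ c-powerful with k ^ n + r ≤? (k * r) ^ 6
  ... | yes small = ≤-trans small (m≤n⊔m B _)
  ... | no large  = ≤-trans (abc-bound (k ^ n) r (k ^ n + r) (m^n>0 k n) r>0 kⁿ⊥r kⁿ⊥c r⊥c refl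
                              (powerful-^-+-rad⁶<c⁴ n c-powerful (≰⇒> large)))
                            (m≤m⊔n B _)
    where
    kⁿ⊥r : Coprime (k ^ n) r
    kⁿ⊥r = coprime-^ k⊥r n
    kⁿ⊥c : Coprime (k ^ n) (k ^ n + r)
    kⁿ⊥c = proj₁ (coprime⇒coprime-+ kⁿ⊥r)
    r⊥c : Coprime r (k ^ n + r)
    r⊥c = proj₂ (coprime⇒coprime-+ kⁿ⊥r)
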